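{- Let $k\ge 2$ be an integer, let $G$ be a non-complete graph having a universal vertex $u$ (adjacent to all other vertices), and let $T$ be a $k$-leaf root of $G$. Then $\mathrm{dist}_T(u,z)\le k-\mathrm{rad}(T)+\mathrm{odd}(T)$ for every center vertex $z$ of $T$. Moreover, if $T$ has two distinct center vertices $z_1\ne z_2$, then $\mathrm{dist}_T(u,z_1)\le k-\mathrm{rad}(T)$ or $\mathrm{dist}_T(u,z_2)\le k-\mathrm{rad}(T)$.
   Context: For an integer $k\ge 2$, a $k$-leaf root of a graph $G$ is a tree $T$ whose leaf set is exactly $V(G)$ such that for all distinct $x,y\in V(G)$, $xy\in E(G)$ iff $\mathrm{dist}_T(x,y)\le k$. For a tree $T$: a center vertex is a vertex $z$ minimizing $\max_{x\in V(T)}\mathrm{dist}_T(x,z)$; $\mathrm{rad}(T)$ is this minimum value; $\mathrm{diam}(T)$ is the maximum distance between two vertices; $\mathrm{odd}(T)=\mathrm{diam}(T)\bmod 2$. -}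

module Defs where

open import Level using (0ℓ)
open import Data.Nat using (ℕ; zero; suc; _+_; _≤_; _%_)
open import Data.Fin using (Fin)
open import Data.List using (List; length; head; last)
open import Data.Maybe using (just)
open import Data.List.Relation.Unary.Linked using (Linked)
open import Data.List.Relation.Unary.Unique.Propositional using (Unique)
open import Data.Product using (Σ; ∃; ∃-syntax; _×_)
open import Relation.Binary.PropositionalEquality using (_≡_; _≢_)
open import Relation.Nullary using (¬_)
open import Function.Definitions using (Injective)

record Graph (n : ℕ) : Set₁ where
  field
    Adj   : Fin n → Fin n → Set
    sym   : ∀ {x y} → Adj x y → Adj y x
    irrefl : ∀ {x} → ¬ Adj x x
open Graph public

module _ {n : ℕ} (G : Graph n) where

  data Walk : Fin n → Fin n → ℕ → Set where
    here : ∀ {x} → Walk x x 0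
    step : ∀ {x y z ℓ} → Adj G x y → Walk y z ℓ → Walk x z (suc ℓ)

  Dist : Fin n → Fin n → ℕ → Set
  Dist x y d = Walk x y d × (∀ ℓ → Walk x y ℓ → d ≤ ℓ)

  Connected : Set
  Connected = ∀ x y → ∃[ ℓ ] Walk x y ℓ

  IsCycle : List (Fin n) → Set
  IsCycle vs = (3 ≤ length vs) × Unique vs × Linked (Adj G) vs
             × Σ (Fin n) (λ a → Σ (Fin n) (λ b →
                 head vs ≡ just a × last vs ≡ just b × Adj G b a))

  Acyclic : Set
  Acyclic = ∀ vs → ¬ IsCycle vs

  IsTree : Set
  IsTree = Connected × Acyclic

  Leaf : Fin n → Set
  Leaf v = Σ (Fin n) (λ w → Adj G v w × (∀ w′ → Adj G v w′ → w′ ≡ w))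

  Ecc : Fin n → ℕ → Set
  Ecc z e = (∀ x → ∃[ d ] (Dist x z d × d ≤ e)) × (∃[ x ] Dist x z e)

  Rad : ℕ → Set
  Rad r = (∃[ z ] Ecc z r) × (∀ z e → Ecc z e → r ≤ e)

  Center : Fin n → Set
  Center z = ∃[ e ] (Ecc z e × (∀ z′ e′ → Ecc z′ e′ → e ≤ e′))

  Diam : ℕ → Set
  Diam D = (∃[ x ] ∃[ y ] Dist x y D) × (∀ x y d → Dist x y d → d ≤ D)

-- T (tree on Fin m) is a k-leaf root of G (graph on Fin n) via the embedding ι,
-- which identifies V(G) with exactly the leaf set of T.
record LeafRoot (k : ℕ) {n m : ℕ} (G : Graph n) (T : Graph m) : Set where
  field
    tree     : IsTree T
    ι        : Fin n → Fin m
    ι-inj    : Injective _≡_ _≡_ ι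
    ι-leaf   : ∀ x → Leaf T (ι x)
    leaf-ι   : ∀ v → Leaf T v → ∃[ x ] ι x ≡ v
    edge⇒    : ∀ x y → x ≢ y → Adj G x y → ∃[ d ] (Dist T (ι x) (ι y) d × d ≤ k)
    ⇒edge    : ∀ x y → x ≢ y → ∀ d → Dist T (ι x) (ι y) d → d ≤ k → Adj G x y

{-# OPTIONS --safe #-}
-- Let a = p 0, …, p D = b be a longest path of T.  Its ends are leaves, hence vertices of G
-- adjacent to u, so d(u, a) ≤ k and d(u, b) ≤ k.  In a tree, the distance from a fixed vertex
-- to p i changes by one at each step and has no local maximum, so as a function of i it is
-- V-shaped.  Applied to a center z this puts z on the path at a position t with D - r ≤ t ≤ r,
-- where 2r ≤ D + D mod 2; applied to u it gives d(u, p t) + t ≤ d(u, a) before the bottom of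
-- the V and d(u, p t) + D - t ≤ d(u, b) after it, and either way d(u, z) + r ≤ k + D mod 2.
-- Two centers only occur for odd D, at positions r - 1 and r: if the V of u bottoms out at or
-- after r, the first estimate at r gives d(u, z) + r ≤ k, and otherwise the second one at r - 1.

module Submission where

open import Defs hiding (sym)
open import Data.Nat
open import Data.Nat.Properties
open import Data.Nat.DivMod using (m≡m%n+[m/n]*n; m%n<n)
open import Data.Nat.Tactic.RingSolver using (solve-∀)
open import Algebra.Properties.CommutativeSemigroup +-commutativeSemigroup using (xy∙z≈xz∙y)
open import Data.Fin as Fin using (Fin)
open import Data.List.Properties using (length-++-≤ʳ; ∷-injectiveˡ)
open import Data.List using (List; []; _∷_; _++_; length; head; last; allFin)
open import Data.List.Relation.Unary.Linked as Linked using (Linked; [-]; _∷_)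
open import Data.List.Relation.Unary.All as All using (All; []; _∷_)
open import Data.List.Relation.Unary.All.Properties
  using (¬Any⇒All¬; All¬⇒¬Any) renaming (++⁻ˡ to All-++⁻ˡ)
open import Data.List.Relation.Unary.Any using (here; there)
open import Data.List.Relation.Unary.AllPairs using ([]; _∷_)
open import Data.List.Relation.Unary.Unique.Propositional using (Unique)
import Data.List.Relation.Unary.Unique.Propositional.Properties as Unique
open import Data.List.Membership.Propositional using (_∈_; _∉_)
open import Data.List.Membership.Propositional.Properties
  using (∈-∃++; ∈-++⁺ˡ; ∈-++⁺ʳ; ∈-allFin)
open import Data.List.Extrema.Nat using (argmax; f[xs]≤f[argmax])
open import Data.Maybe using (just)
open import Data.Maybe.Properties using (just-injective)
open import Function using (_∘_)
open import Data.Product using (Σ-syntax; ∃-syntax; _×_; _,_; proj₁; proj₂)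
open import Data.Sum using (_⊎_; inj₁; inj₂; swap; [_,_]′)
open import Data.Empty using (⊥; ⊥-elim)
open import Relation.Nullary using (¬_; yes; no)
open import Relation.Binary.PropositionalEquality
open import Relation.Binary.Definitions using (tri<; tri≈; tri>)

module _ {A : Set} where

  lastOf : A → List A → A
  lastOf x []       = x
  lastOf _ (y ∷ ys) = lastOf y ys

  lastOf-++ : ∀ (x : A) pre w post → lastOf x (pre ++ w ∷ post) ≡ lastOf w post
  lastOf-++ x []        w post = refl
  lastOf-++ x (y ∷ pre) w post = lastOf-++ y pre w post

  last≡lastOf : ∀ (x : A) xs → last (x ∷ xs) ≡ just (lastOf x xs)
  last≡lastOf x []       = refl
  last≡lastOf x (y ∷ ys) = last≡lastOf y ys

  lastOf-∈ : ∀ (x : A) xs → lastOf x xs ∈ x ∷ xs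
  lastOf-∈ x []       = here refl
  lastOf-∈ x (y ∷ ys) = there (lastOf-∈ y ys)

  -- The i-th entry of x ∷ xs, clamped to the last one.
  at : A → List A → ℕ → A
  at x xs       zero    = x
  at x []       (suc i) = x
  at x (y ∷ ys) (suc i) = at y ys i

  at-length : ∀ (x : A) xs → at x xs (length xs) ≡ lastOf x xs
  at-length x []       = refl
  at-length x (y ∷ ys) = at-length y ys

  at-∈ : ∀ (x : A) xs i → at x xs i ∈ x ∷ xs
  at-∈ x xs       zero    = here refl
  at-∈ x []       (suc i) = here refl
  at-∈ x (y ∷ ys) (suc i) = there (at-∈ y ys i)

  Linked-at : ∀ {R : A → A → Set} x xs i → Linked R (x ∷ xs) → i < length xs →
              R (at x xs i) (at x xs (suc i))
  Linked-at x (y ∷ ys) zero    (xy ∷ _) _         = xy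
  Linked-at x (y ∷ ys) (suc i) (_ ∷ l)  (s≤s i<n) = Linked-at y ys i l i<n

  Unique-at : ∀ (x : A) xs i → Unique (x ∷ xs) → suc i < length xs →
              at x xs i ≢ at x xs (suc (suc i))
  Unique-at x (y ∷ ys) zero    (x∉ ∷ _) _         = All.lookup x∉ (at-∈ y ys 1)
  Unique-at x (y ∷ ys) (suc i) (_ ∷ u)  (s≤s i<n) = Unique-at y ys i u i<n

  Linked-++⁻ʳ : ∀ {R : A → A → Set} pre {xs} → Linked R (pre ++ xs) → Linked R xs
  Linked-++⁻ʳ []        l = l
  Linked-++⁻ʳ (_ ∷ pre) l = Linked-++⁻ʳ pre (Linked.tail l)

  Linked-++⁻ˡ : ∀ {R : A → A → Set} x pre w post → Linked R (x ∷ pre ++ w ∷ post) →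
                Linked R (x ∷ pre) × R (lastOf x pre) w
  Linked-++⁻ˡ x []        w post (xw ∷ _) = [-] , xw
  Linked-++⁻ˡ x (y ∷ pre) w post (xy ∷ l) with Linked-++⁻ˡ y pre w post l
  ... | l′ , r = xy ∷ l′ , r

  Linked-++⁺ : ∀ {R : A → A → Set} x xs y ys → Linked R (x ∷ xs) → R (lastOf x xs) y →
               Linked R (y ∷ ys) → Linked R ((x ∷ xs) ++ y ∷ ys)
  Linked-++⁺ x []        y ys [-]        r l = r ∷ l
  Linked-++⁺ x (x′ ∷ xs) y ys (xx′ ∷ l′) r l = xx′ ∷ Linked-++⁺ x′ xs y ys l′ r l

  Unique-++⁻ʳ : ∀ pre {xs : List A} → Unique (pre ++ xs) → Unique xs
  Unique-++⁻ʳ []        u       = u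
  Unique-++⁻ʳ (_ ∷ pre) (_ ∷ u) = Unique-++⁻ʳ pre u

  Unique-++⁻ˡ : ∀ pre {xs : List A} → Unique (pre ++ xs) → Unique pre
  Unique-++⁻ˡ []        _         = []
  Unique-++⁻ˡ (_ ∷ pre) (x∉ ∷ u) = All-++⁻ˡ pre x∉ ∷ Unique-++⁻ˡ pre u

  ∉-Unique-prefix : ∀ pre {w : A} {post} → Unique (pre ++ w ∷ post) → w ∉ pre
  ∉-Unique-prefix (_ ∷ pre) (x∉ ∷ _) (here refl) = All.lookup x∉ (∈-++⁺ʳ pre (here refl)) refl
  ∉-Unique-prefix (_ ∷ pre) (_ ∷ u)  (there w∈) = ∉-Unique-prefix pre u w∈

  cycle-length : ∀ (w x : A) C pre → (C ≡ [] → pre ≢ []) → 3 ≤ length ((w ∷ C) ++ x ∷ pre)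
  cycle-length w x []      []      nonempty = ⊥-elim (nonempty refl refl)
  cycle-length w x []      (_ ∷ _) _        = s≤s (s≤s (s≤s z≤n))
  cycle-length w x (_ ∷ C) pre     _        =
    s≤s (s≤s (≤-trans (s≤s z≤n) (length-++-≤ʳ (x ∷ pre) {C})))


-- On [0, D], f i ≡ bottom + ∣ i - apex ∣.
record VShaped (f : ℕ → ℕ) (D : ℕ) : Set where
  field
    apex    : ℕ
    bottom  : ℕ
    apex≤D  : apex ≤ D
    descent : ∀ i → i ≤ apex → f i + i ≡ bottom + apex
    ascent  : ∀ i → apex ≤ i → i ≤ D → f i + apex ≡ bottom + i

module _ {f : ℕ → ℕ} {D : ℕ} (V : VShaped f D) where
  open VShaped V
  open ≤-Reasoning

  at-start : f 0 ≡ bottom + apex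
  at-start = trans (sym (+-identityʳ (f 0))) (descent 0 z≤n)

  at-end : f D + apex ≡ bottom + D
  at-end = ascent D apex≤D ≤-refl

  at-apex : f apex ≡ bottom
  at-apex = +-cancelʳ-≡ apex _ _ (descent apex ≤-refl)

  before-apex : ∀ i → i ≤ apex → f i + i ≡ f 0
  before-apex i i≤a = trans (descent i i≤a) (sym at-start)

  after-apex : ∀ i → apex ≤ i → i ≤ D → f i + D ≡ f D + i
  after-apex i a≤i i≤D = +-cancelʳ-≡ apex _ _ (begin-equality
    f i + D + apex    ≡⟨ xy∙z≈xz∙y (f i) D apex ⟩
    f i + apex + D    ≡⟨ cong (_+ D) (ascent i a≤i i≤D) ⟩
    bottom + i + D    ≡⟨ xy∙z≈xz∙y bottom i D ⟩
    bottom + D + i    ≡⟨ cong (_+ i) (sym at-end) ⟩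
    f D + apex + i    ≡⟨ xy∙z≈xz∙y (f D) apex i ⟩
    f D + i + apex    ∎)

  bottom≤apex : f D ≤ D → bottom ≤ apex
  bottom≤apex fD≤D = +-cancelʳ-≤ D _ _ (begin
    bottom + D  ≡⟨ sym at-end ⟩
    f D + apex  ≤⟨ +-monoˡ-≤ apex fD≤D ⟩
    D + apex    ≡⟨ +-comm D apex ⟩
    apex + D    ∎)

  midpoint-bound : f 0 ≤ D → f D ≤ D → ∀ c → c ≤ D → D ≤ c + c → f c ≤ c
  midpoint-bound f0≤D fD≤D c c≤D D≤2c with ≤-total c apex
  ... | inj₁ c≤a = +-cancelʳ-≤ c _ _ (begin
    f c + c  ≡⟨ before-apex c c≤a ⟩
    f 0      ≤⟨ f0≤D ⟩
    D        ≤⟨ D≤2c ⟩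
    c + c    ∎)
  ... | inj₂ a≤c = +-cancelʳ-≤ apex _ _ (begin
    f c + apex  ≡⟨ ascent c a≤c c≤D ⟩
    bottom + c  ≤⟨ +-monoˡ-≤ c (bottom≤apex fD≤D) ⟩
    apex + c    ≡⟨ +-comm apex c ⟩
    c + apex    ∎)

  -- A vertex within r of both ends of a path of length D ≥ 2r - 1 lies on the path.
  bottom≡0 : ∀ r → f 0 ≤ r → f D ≤ r → r + r ≤ suc D → bottom ≡ 0
  bottom≡0 r f0≤r fD≤r 2r≤1+D = double≤1⇒0 bottom (+-cancelʳ-≤ (apex + D) _ _ (begin
    bottom + bottom + (apex + D)  ≡⟨ regroup bottom apex D ⟩
    (bottom + apex) + (bottom + D) ≡⟨ cong₂ _+_ (sym at-start) (sym at-end) ⟩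
    f 0 + (f D + apex)            ≤⟨ +-mono-≤ f0≤r (+-monoˡ-≤ apex fD≤r) ⟩
    r + (r + apex)                ≡⟨ sym (+-assoc r r apex) ⟩
    r + r + apex                  ≤⟨ +-monoˡ-≤ apex 2r≤1+D ⟩
    suc D + apex                  ≡⟨ cong suc (+-comm D apex) ⟩
    1 + (apex + D)                ∎))
    where
      regroup : ∀ b a D → b + b + (a + D) ≡ (b + a) + (b + D)
      regroup = solve-∀
      double≤1⇒0 : ∀ b → b + b ≤ 1 → b ≡ 0
      double≤1⇒0 zero    _          = refl
      double≤1⇒0 (suc b) (s≤s b+1+b≤0) with () ← subst (_≤ 0) (+-suc b b) b+1+b≤0

  neighbour-of-start : f 0 ≡ 1 → f D ≤ D → f 1 ≡ 0
  neighbour-of-start f0≡1 fD≤D with apex | bottom | trans (sym f0≡1) at-start | at-end | at-apex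
  ... | zero | b | 1≡b+0 | end | _ = ⊥-elim (1+n≰n (begin
    suc D      ≡⟨ cong (_+ D) (trans 1≡b+0 (+-identityʳ b)) ⟩
    b + D      ≡⟨ sym end ⟩
    f D + 0    ≡⟨ +-identityʳ (f D) ⟩
    f D        ≤⟨ fD≤D ⟩
    D          ∎))
  ... | 1 | b | 1≡b+1 | _ | at-1 = trans at-1 (+-cancelʳ-≡ 1 b 0 (sym 1≡b+1))
  ... | suc (suc a) | b | 1≡b+2+a | _ | _ =
    ⊥-elim (2+n≰1 (subst (suc (suc a) ≤_) (sym 1≡b+2+a) (m≤n+m _ b)))
    where
      2+n≰1 : suc (suc a) ≰ 1
      2+n≰1 (s≤s ())

extend-ascent : ∀ {f D} (V : VShaped f D) → f (suc D) ≡ suc (f D) → VShaped f (suc D)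
extend-ascent {f} {D} V up = record
  { apex = apex ; bottom = bottom ; apex≤D = m≤n⇒m≤1+n apex≤D
  ; descent = descent ; ascent = ascent′ }
  where
    open VShaped V
    ascent′ : ∀ i → apex ≤ i → i ≤ suc D → f i + apex ≡ bottom + i
    ascent′ i a≤i i≤1+D with m≤n⇒m<n∨m≡n i≤1+D
    ... | inj₁ (s≤s i≤D) = ascent i a≤i i≤D
    ... | inj₂ refl = begin
      f (suc D) + apex  ≡⟨ cong (_+ apex) up ⟩
      suc (f D + apex)  ≡⟨ cong suc (ascent D apex≤D ≤-refl) ⟩
      suc (bottom + D)  ≡⟨ sym (+-suc bottom D) ⟩
      bottom + suc D    ∎
      where open ≡-Reasoning

turn-at-end : ∀ {f D} (V : VShaped f D) → VShaped.apex V ≡ D → f D ≡ suc (f (suc D)) →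
              VShaped f (suc D)
turn-at-end {f} {D} V a≡D down = record
  { apex = suc D ; bottom = f (suc D) ; apex≤D = ≤-refl ; descent = descent′ ; ascent = ascent′ }
  where
    open VShaped V
    descent′ : ∀ i → i ≤ suc D → f i + i ≡ f (suc D) + suc D
    descent′ i i≤1+D with m≤n⇒m<n∨m≡n i≤1+D
    ... | inj₂ refl = refl
    ... | inj₁ (s≤s i≤D) = begin
      f i + i                ≡⟨ descent i (subst (i ≤_) (sym a≡D) i≤D) ⟩
      bottom + apex          ≡⟨ cong₂ _+_ (trans (sym (at-apex V)) (cong f a≡D)) a≡D ⟩
      f D + D                ≡⟨ cong (_+ D) down ⟩
      suc (f (suc D)) + D    ≡⟨ sym (+-suc (f (suc D)) D) ⟩
      f (suc D) + suc D      ∎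
      where open ≡-Reasoning
    ascent′ : ∀ i → suc D ≤ i → i ≤ suc D → f i + suc D ≡ f (suc D) + i
    ascent′ i 1+D≤i i≤1+D with refl ← ≤-antisym 1+D≤i i≤1+D = refl

rises-after-apex : ∀ {f D} (V : VShaped f (suc D)) → VShaped.apex V ≤ D → f (suc D) ≡ suc (f D)
rises-after-apex {f} {D} V a≤D = +-cancelʳ-≡ apex _ _ (begin
  f (suc D) + apex  ≡⟨ ascent (suc D) (m≤n⇒m≤1+n a≤D) ≤-refl ⟩
  bottom + suc D    ≡⟨ +-suc bottom D ⟩
  suc (bottom + D)  ≡⟨ cong suc (sym (ascent D a≤D (n≤1+n D))) ⟩
  suc (f D + apex)  ∎)
  where
    open VShaped V
    open ≡-Reasoning

UnitSteps : (ℕ → ℕ) → ℕ → Set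
UnitSteps f D = ∀ i → i < D → f i ≡ suc (f (suc i)) ⊎ f (suc i) ≡ suc (f i)

NoPeak : (ℕ → ℕ) → ℕ → Set
NoPeak f D = ∀ i → suc i < D → f (suc i) ≡ suc (f i) → f (suc i) ≡ suc (f (suc (suc i))) → ⊥

peak-after-apex : ∀ {f D} (V : VShaped f D) → VShaped.apex V < D → NoPeak f (suc D) →
                  f D ≡ suc (f (suc D)) → ⊥
peak-after-apex {D = suc D} V (s≤s a≤D) noPeak down = noPeak D ≤-refl (rises-after-apex V a≤D) down

vShaped : ∀ {f} D → UnitSteps f D → NoPeak f D → VShaped f D
vShaped {f} zero _ _ = record
  { apex = 0 ; bottom = f 0 ; apex≤D = z≤n
  ; descent = λ { _ z≤n → refl } ; ascent = λ { _ z≤n z≤n → refl } }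
vShaped {f} (suc D) steps noPeak
  with vShaped D (λ i i<D → steps i (m≤n⇒m≤1+n i<D)) (λ i i<D → noPeak i (m≤n⇒m≤1+n i<D))
     | steps D ≤-refl
... | V | inj₂ up   = extend-ascent V up
... | V | inj₁ down with m≤n⇒m<n∨m≡n (VShaped.apex≤D V)
...   | inj₂ a≡D = turn-at-end V a≡D down
...   | inj₁ a<D = ⊥-elim (peak-after-apex V a<D noPeak down)

ceil-half : ∀ D → Σ[ c ∈ ℕ ] c ≤ D × c + c ≡ D + D % 2
ceil-half D = q + ρ , c≤D , c+c≡D+ρ
  where
    q = D / 2
    ρ = D % 2
    D≡ρ+2q : D ≡ ρ + q * 2
    D≡ρ+2q = m≡m%n+[m/n]*n D 2
    c≤D : q + ρ ≤ D
    c≤D = subst (q + ρ ≤_) (trans (reorder q ρ) (sym D≡ρ+2q)) (m≤m+n (q + ρ) q)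
      where
        reorder : ∀ q ρ → q + ρ + q ≡ ρ + q * 2
        reorder = solve-∀
    c+c≡D+ρ : q + ρ + (q + ρ) ≡ D + ρ
    c+c≡D+ρ = trans (double q ρ) (cong (_+ ρ) (sym D≡ρ+2q))
      where
        double : ∀ q ρ → q + ρ + (q + ρ) ≡ ρ + q * 2 + ρ
        double = solve-∀

adjacent-positions : ∀ {r D s t} → r + r ≤ suc D → s < t → D ≤ r + s → t ≤ r →
                     t ≡ r × suc s ≡ r
adjacent-positions {r} {D} {s} 2r≤1+D s<t D≤r+s t≤r =
  ≤-antisym t≤r (≤-trans r≤1+s s<t) , ≤-antisym (≤-trans s<t t≤r) r≤1+s
  where
    r≤1+s : r ≤ suc s
    r≤1+s = +-cancelˡ-≤ r r (suc s) (begin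
      r + r       ≤⟨ 2r≤1+D ⟩
      suc D       ≤⟨ s≤s D≤r+s ⟩
      suc (r + s) ≡⟨ sym (+-suc r s) ⟩
      r + suc s   ∎)
      where open ≤-Reasoning

two-positions : ∀ {r D t₁ t₂} → r + r ≤ suc D → t₁ ≢ t₂ →
                t₁ ≤ r → D ≤ r + t₁ → t₂ ≤ r → D ≤ r + t₂ →
                (t₁ ≡ r × suc t₂ ≡ r) ⊎ (t₂ ≡ r × suc t₁ ≡ r)
two-positions {t₁ = t₁} {t₂} 2r≤1+D t₁≢t₂ t₁≤r D≤r+t₁ t₂≤r D≤r+t₂
  with <-cmp t₁ t₂
... | tri< t₁<t₂ _ _ = inj₂ (adjacent-positions 2r≤1+D t₁<t₂ D≤r+t₁ t₂≤r)
... | tri≈ _ t₁≡t₂ _ = ⊥-elim (t₁≢t₂ t₁≡t₂)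
... | tri> _ _ t₂<t₁ = inj₁ (adjacent-positions 2r≤1+D t₂<t₁ D≤r+t₂ t₁≤r)

module Paths {m : ℕ} (G : Graph m) where

  open import Data.List.Membership.DecPropositional (Fin._≟_ {m}) using (_∈?_)

  reverse-onto : ∀ {x y w a b} → Walk G x y a → Walk G x w b → Walk G y w (a + b)
  reverse-onto here acc = acc
  reverse-onto {b = b} (step {ℓ = a} xy W) acc =
    subst (Walk G _ _) (+-suc a b) (reverse-onto W (step (Graph.sym G xy) acc))

  IsPath : List (Fin m) → Set
  IsPath vs = Linked (Adj G) vs × Unique vs

  -- The vertices of the path are x ∷ route.
  record Path (x y : Fin m) : Set where
    constructor path
    field
      route  : List (Fin m)
      isPath : IsPath (x ∷ route)
      ends   : lastOf x route ≡ y

  open Path public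

  len : ∀ {x y} → Path x y → ℕ
  len P = length (route P)

  linked⇒walk : ∀ x vs → Linked (Adj G) (x ∷ vs) → Walk G x (lastOf x vs) (length vs)
  linked⇒walk x []       _        = here
  linked⇒walk x (y ∷ vs) (xy ∷ l) = step xy (linked⇒walk y vs l)

  path⇒walk : ∀ {x y} (P : Path x y) → Walk G x y (len P)
  path⇒walk {x} (path vs (l , _) refl) = linked⇒walk x vs l

  prepend : ∀ {v x y} → Adj G v x → (P : Path x y) → v ∉ x ∷ route P → Path v y
  prepend {x = x} vx (path vs (l , u) e) v∉ = path (x ∷ vs) (vx ∷ l , ¬Any⇒All¬ _ v∉ ∷ u) e

  suffix : ∀ {x y w} (P : Path x y) → w ∈ route P → Σ[ Q ∈ Path w y ] len Q < len P
  suffix {x} (path vs (l , u) e) w∈ with ∈-∃++ w∈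
  ... | pre , post , refl =
    path post (Linked-++⁻ʳ (x ∷ pre) l , Unique-++⁻ʳ (x ∷ pre) u)
         (trans (sym (lastOf-++ x pre _ post)) e) ,
    length-++-≤ʳ (_ ∷ post) {pre}

  walk⇒path : ∀ {x y ℓ} → Walk G x y ℓ → Σ[ P ∈ Path x y ] len P ≤ ℓ
  walk⇒path here = path [] ([-] , [] ∷ []) refl , z≤n
  walk⇒path {x} (step {y = y} xy W) with walk⇒path W
  ... | P , P≤ℓ with x ∈? y ∷ route P
  ...   | yes (here refl)  = P , m≤n⇒m≤1+n P≤ℓ
  ...   | yes (there x∈P)  =
    let Q , Q<P = suffix P x∈P in Q , <⇒≤ (<-≤-trans Q<P (m≤n⇒m≤1+n P≤ℓ))
  ...   | no x∉P           = prepend xy P x∉P , s≤s P≤ℓ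

  module _ (acyclic : Acyclic G) where

    closing-cycle : ∀ {x Ps w C} → IsPath (x ∷ Ps) → IsPath (w ∷ C) → Adj G (lastOf w C) x →
                    All (_∉ x ∷ Ps) C → w ∈ Ps → (C ≡ [] → head Ps ≢ just w) → ⊥
    closing-cycle {x} {w = w} {C} (lP , uP) (lC , uC) back C∉P w∈Ps fresh with ∈-∃++ w∈Ps
    ... | pre , post , refl =
      acyclic ((w ∷ C) ++ x ∷ pre)
        ( cycle-length w x C pre
            (λ C≡[] pre≡[] → fresh C≡[] (cong (λ p → head (p ++ w ∷ post)) pre≡[]))
        , Unique.++⁺ uC (Unique-++⁻ˡ (x ∷ pre) uP) disjoint
        , Linked-++⁺ w C x pre lC back (proj₁ along)
        , w , lastOf x pre , refl
        , trans (last≡lastOf w (C ++ x ∷ pre)) (cong just (lastOf-++ w C x pre))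
        , proj₂ along )
      where
        along = Linked-++⁻ˡ x pre w post lP
        disjoint : ∀ {v} → ¬ (v ∈ w ∷ C × v ∈ x ∷ pre)
        disjoint (here refl , w∈) = ∉-Unique-prefix (x ∷ pre) uP w∈
        disjoint (there v∈C , v∈) = All.lookup C∉P v∈C (∈-++⁺ˡ v∈)

    -- Walk along a second route w ∷ R to the end of the path x ∷ Ps, keeping the part
    -- already walked, reversed, as w ∷ C (which leads back to x): the first vertex met
    -- that lies on x ∷ Ps closes a cycle.
    no-detour : ∀ {x Ps} → IsPath (x ∷ Ps) →
                ∀ w R C → IsPath (w ∷ R) → lastOf w R ≡ lastOf x Ps →
                IsPath (w ∷ C) → Adj G (lastOf w C) x →
                All (_∉ x ∷ Ps) C → All (_∉ C) R → x ∉ w ∷ R →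
                (C ≡ [] → head Ps ≢ just w) → ⊥
    no-detour {x} {Ps} P w R C _ _ pC back C∉P _ x∉R fresh with w ∈? x ∷ Ps
    ... | yes (here refl)  = x∉R (here refl)
    ... | yes (there w∈Ps) = closing-cycle P pC back C∉P w∈Ps fresh
    no-detour {x} {Ps} P w [] C _ ends _ _ _ _ _ _ | no w∉P =
      w∉P (subst (_∈ x ∷ Ps) (sym ends) (lastOf-∈ x Ps))
    no-detour P w (r ∷ R) C (wr ∷ lR , w∉R ∷ uR) ends (lC , uC) back C∉P (r∉C ∷ R∉C) x∉R _
      | no w∉P =
      no-detour P r R (w ∷ C) (lR , uR) ends
        (Graph.sym G wr ∷ lC , ((λ r≡w → All.head w∉R (sym r≡w)) ∷ ¬Any⇒All¬ C r∉C) ∷ uC) back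
        (w∉P ∷ C∉P) (All.zipWith off-wC (All.tail w∉R , R∉C)) (x∉R ∘ there) (λ ())
      where
        off-wC : ∀ {s} → w ≢ s × s ∉ C → s ∉ w ∷ C
        off-wC (w≢s , _)   (here s≡w)  = w≢s (sym s≡w)
        off-wC (_   , s∉C) (there s∈C) = s∉C s∈C

    routes-unique : ∀ {x} xs ys → IsPath (x ∷ xs) → IsPath (x ∷ ys) →
                    lastOf x xs ≡ lastOf x ys → xs ≡ ys
    routes-unique []       []       _              _              _ = refl
    routes-unique []       (y ∷ ys) _            (_ , x∉ ∷ _) e =
      ⊥-elim (All.lookup x∉ (lastOf-∈ y ys) e)
    routes-unique (y ∷ xs) []       (_ , x∉ ∷ _) _            e =
      ⊥-elim (All.lookup x∉ (lastOf-∈ y xs) (sym e))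
    routes-unique (a ∷ xs) (b ∷ ys) P@(_ , _ ∷ uP) (xb ∷ lQ , x∉Q ∷ uQ) e with a Fin.≟ b
    ... | yes refl = cong (a ∷_) (routes-unique xs ys (Linked.tail (proj₁ P) , uP) (lQ , uQ) e)
    ... | no a≢b   = ⊥-elim (no-detour P b ys [] (lQ , uQ) (sym e) ([-] , [] ∷ []) (Graph.sym G xb)
                       [] (All.universal (λ _ ()) ys) (All¬⇒¬Any x∉Q) (λ _ → a≢b ∘ just-injective))

    path-unique : ∀ {x y} (P Q : Path x y) → route P ≡ route Q
    path-unique P Q = routes-unique (route P) (route Q) (isPath P) (isPath Q) (trans (ends P) (sym (ends Q)))

    path-Dist : ∀ {x y} (P : Path x y) → Dist G x y (len P)
    path-Dist P = path⇒walk P , shortest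
      where
        shortest : ∀ ℓ → Walk G _ _ ℓ → len P ≤ ℓ
        shortest ℓ W with walk⇒path W
        ... | Q , Q≤ℓ = subst (_≤ ℓ) (cong length (path-unique Q P)) Q≤ℓ

module TreeDistance {m : ℕ} (T : Graph m) (tree : IsTree T) where

  open import Data.List.Membership.DecPropositional (Fin._≟_ {m}) using (_∈?_)
  open Paths T public

  geodesic : ∀ x y → Path x y
  geodesic x y = proj₁ (walk⇒path (proj₂ (proj₁ tree x y)))

  d : Fin m → Fin m → ℕ
  d x y = len (geodesic x y)

  d-Dist : ∀ x y → Dist T x y (d x y)
  d-Dist x y = path-Dist (proj₂ tree) (geodesic x y)

  d≤walk : ∀ {x y ℓ} → Walk T x y ℓ → d x y ≤ ℓ
  d≤walk {x} {y} W = proj₂ (d-Dist x y) _ W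

  Dist⇒≡d : ∀ {x y e} → Dist T x y e → e ≡ d x y
  Dist⇒≡d {x} {y} (W , shortest) = ≤-antisym (shortest _ (proj₁ (d-Dist x y))) (d≤walk W)

  len≡d : ∀ {x y} (P : Path x y) → len P ≡ d x y
  len≡d P = Dist⇒≡d (path-Dist (proj₂ tree) P)

  d≡0⇒≡ : ∀ {x y} → d x y ≡ 0 → x ≡ y
  d≡0⇒≡ {x} {y} e = empty-walk (subst (Walk T x y) e (proj₁ (d-Dist x y)))
    where
      empty-walk : Walk T x y 0 → x ≡ y
      empty-walk here = refl

  Adj⇒d≡1 : ∀ {x y} → Adj T x y → d x y ≡ 1
  Adj⇒d≡1 {x} xy = ≤-antisym (d≤walk (step xy here))
    (n≢0⇒n>0 (λ e → Graph.irrefl T (subst (Adj T x) (sym (d≡0⇒≡ e)) xy)))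

  d-sym : ∀ x y → d x y ≡ d y x
  d-sym x y = ≤-antisym (reversed y x) (reversed x y)
    where
      reversed : ∀ x y → d y x ≤ d x y
      reversed x y = d≤walk (subst (Walk T y x) (+-identityʳ _) (reverse-onto (proj₁ (d-Dist x y)) here))

  closer⊎through : ∀ {v w} x → Adj T v w →
                   d v x < d w x ⊎ route (geodesic v x) ≡ w ∷ route (geodesic w x)
  closer⊎through {v} {w} x vw with v ∈? w ∷ route (geodesic w x)
  ... | yes (here refl)  = ⊥-elim (Graph.irrefl T vw)
  ... | yes (there v∈P) =
    let Q , Q<P = suffix (geodesic w x) v∈P in inj₁ (subst (_< d w x) (len≡d Q) Q<P)
  ... | no v∉P =
    inj₂ (path-unique (proj₂ tree) (geodesic v x) (prepend vw (geodesic w x) v∉P))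

  adjacent-distances : ∀ {v w} x → Adj T v w → d v x ≡ suc (d w x) ⊎ d w x ≡ suc (d v x)
  adjacent-distances {v} x vw with closer⊎through x vw
  ... | inj₁ v<w = inj₂ (≤-antisym (d≤walk (step (Graph.sym T vw) (proj₁ (d-Dist v x)))) v<w)
  ... | inj₂ via = inj₁ (cong length via)

  closer-neighbour-unique : ∀ {v w w′} x → Adj T v w → Adj T v w′ →
                            d v x ≡ suc (d w x) → d v x ≡ suc (d w′ x) → w ≡ w′
  closer-neighbour-unique {v} x vw vw′ e e′ =
    ∷-injectiveˡ (trans (sym (through vw e)) (through vw′ e′))
    where
      through : ∀ {w} → Adj T v w → d v x ≡ suc (d w x) →
                route (geodesic v x) ≡ w ∷ route (geodesic w x)
      through vw e with closer⊎through x vw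
      ... | inj₁ v<w = ⊥-elim (1+n≰n (≤-trans (n≤1+n _) (subst (λ t → suc t ≤ _) e v<w)))
      ... | inj₂ via = via

  farthest : Fin m → Fin m
  farthest z = argmax (λ x → d x z) z (allFin m)

  Ecc-farthest : ∀ z → Ecc T z (d (farthest z) z)
  Ecc-farthest z =
    (λ x → d x z , d-Dist x z ,
           All.lookup (f[xs]≤f[argmax] {f = λ x → d x z} z (allFin m)) (∈-allFin x)) ,
    farthest z , d-Dist (farthest z) z

  Ecc⇒d≤ : ∀ {z e} → Ecc T z e → ∀ x → d x z ≤ e
  Ecc⇒d≤ (within , _) x with within x
  ... | e′ , Dist-e′ , e′≤e = subst (_≤ _) (Dist⇒≡d Dist-e′) e′≤e

  Diam⇒d≤ : ∀ {D} → Diam T D → ∀ x y → d x y ≤ D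
  Diam⇒d≤ (_ , longest) x y = longest x y (d x y) (d-Dist x y)

  vertexAt : ∀ {a b} → Path a b → ℕ → Fin m
  vertexAt {a} P = at a (route P)

  vertexAt-len : ∀ {a b} (P : Path a b) → vertexAt P (len P) ≡ b
  vertexAt-len {a} P = trans (at-length a (route P)) (ends P)

  vertexAt-Adj : ∀ {a b} (P : Path a b) i → i < len P → Adj T (vertexAt P i) (vertexAt P (suc i))
  vertexAt-Adj {a} P i = Linked-at a (route P) i (proj₁ (isPath P))

  along-path-vShaped : ∀ {a b} (P : Path a b) x → VShaped (λ i → d (vertexAt P i) x) (len P)
  along-path-vShaped {a} P x = vShaped (len P)
    (λ i i<D → adjacent-distances x (vertexAt-Adj P i i<D))
    (λ i i+1<D up down → Unique-at a (route P) i (proj₂ (isPath P)) i+1<D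
       (closer-neighbour-unique x (Graph.sym T (vertexAt-Adj P i (<⇒≤ i+1<D)))
                                  (vertexAt-Adj P (suc i) i+1<D) up down))

  diametral-end-leaf : ∀ a b → (∀ x y → d x y ≤ d a b) → 0 < d a b → Leaf T a
  diametral-end-leaf a b diametral 0<D = vertexAt P 1 , vertexAt-Adj P 0 0<D , only-neighbour
    where
      P = geodesic a b
      only-neighbour : ∀ w → Adj T a w → w ≡ vertexAt P 1
      only-neighbour w aw =
        sym (d≡0⇒≡ (neighbour-of-start (along-path-vShaped P w) (Adj⇒d≡1 aw) (diametral _ w)))

module Bounds (k : ℕ) {n m : ℕ} (G : Graph n) (T : Graph m) (L : LeafRoot k G T)
              (u : Fin n) (universal : ∀ v → v ≢ u → Adj G u v)
              (r D : ℕ) (rad : Rad T r) (diam : Diam T D) where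

  open LeafRoot L
  open TreeDistance T tree
  open ≤-Reasoning

  u′ : Fin m
  u′ = ι u

  leaf-near-u : ∀ v → Leaf T v → d v u′ ≤ k
  leaf-near-u v leaf with leaf-ι v leaf
  ... | y , refl with y Fin.≟ u
  ...   | yes refl = ≤-trans (d≤walk here) z≤n
  ...   | no y≢u with edge⇒ y u y≢u (Graph.sym G (universal y y≢u))
  ...     | e , Dist-e , e≤k = subst (_≤ k) (Dist⇒≡d Dist-e) e≤k

  a b : Fin m
  a = proj₁ (proj₁ diam)
  b = proj₁ (proj₂ (proj₁ diam))

  D≡d : D ≡ d a b
  D≡d = Dist⇒≡d (proj₂ (proj₂ (proj₁ diam)))

  within-D : ∀ x y → d x y ≤ D
  within-D = Diam⇒d≤ diam

  p : ℕ → Fin m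
  p = vertexAt (geodesic a b)

  p[D]≡b : p D ≡ b
  p[D]≡b = trans (cong p D≡d) (vertexAt-len (geodesic a b))

  profile : ∀ x → VShaped (λ i → d (p i) x) D
  profile x = subst (VShaped _) (sym D≡d) (along-path-vShaped (geodesic a b) x)

  ends-near-u : d a u′ ≤ k × d b u′ ≤ k
  ends-near-u =
    leaf-near-u a (diametral-end-leaf a b (λ x y → subst (d x y ≤_) D≡d (within-D x y)) 0<D) ,
    leaf-near-u b (diametral-end-leaf b a (λ x y → subst (d x y ≤_) D≡d′ (within-D x y))
                                          (subst (0 <_) (d-sym a b) 0<D))
    where
      D≡d′ : D ≡ d b a
      D≡d′ = trans D≡d (d-sym a b)
      0<D : 0 < d a b
      0<D with ι-leaf u
      ... | w , u′w , _ =
        subst (_≤ d a b) (Adj⇒d≡1 u′w) (subst (d u′ w ≤_) D≡d (within-D u′ w))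

  r+r≤D+D%2 : r + r ≤ D + D % 2
  r+r≤D+D%2 with ceil-half D
  ... | c , c≤D , c+c≡D+ρ = subst (r + r ≤_) c+c≡D+ρ (+-mono-≤ r≤c r≤c)
    where
      x = farthest (p c)
      r≤c : r ≤ c
      r≤c = ≤-trans (proj₂ rad (p c) _ (Ecc-farthest (p c)))
        (subst (_≤ c) (d-sym (p c) x)
          (midpoint-bound (profile x) (within-D a x) (within-D (p D) x) c c≤D
            (subst (D ≤_) (sym c+c≡D+ρ) (m≤m+n D (D % 2)))))

  r+r≤1+D : r + r ≤ suc D
  r+r≤1+D =
    ≤-trans r+r≤D+D%2 (subst (D + D % 2 ≤_) (+-comm D 1) (+-monoʳ-≤ D (≤-pred (m%n<n D 2))))

  record OnDiameter (z : Fin m) : Set where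
    field
      position      : ℕ
      p[position]≡z : p position ≡ z
      position≤D    : position ≤ D
      position≤r    : position ≤ r
      D≤r+position  : D ≤ r + position

  open OnDiameter

  center-on-diameter : ∀ z → Center T z → OnDiameter z
  center-on-diameter z (e , ecc , minimal) = record
    { position = apex ; p[position]≡z = d≡0⇒≡ (trans (at-apex V) on-path) ; position≤D = apex≤D
    ; position≤r = subst (_≤ r) (trans (at-start V) (cong (_+ apex) on-path)) (near a)
    ; D≤r+position = begin
        D                 ≡⟨ cong (_+ D) (sym on-path) ⟩
        bottom + D        ≡⟨ sym (at-end V) ⟩
        d (p D) z + apex  ≤⟨ +-monoˡ-≤ apex (near (p D)) ⟩
        r + apex          ∎ }
    where
      V = profile z
      open VShaped V
      near : ∀ x → d x z ≤ r
      near x = ≤-trans (Ecc⇒d≤ ecc x) (minimal _ r (proj₂ (proj₁ rad)))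
      on-path : bottom ≡ 0
      on-path = bottom≡0 V r (near a) (near (p D)) r+r≤1+D

  g : ℕ → ℕ
  g i = d (p i) u′

  profile-u : VShaped g D
  profile-u = profile u′

  g-before : ∀ t → t ≤ VShaped.apex profile-u → g t + t ≤ k
  g-before t t≤a = subst (_≤ k) (sym (before-apex profile-u t t≤a)) (proj₁ ends-near-u)

  g-after : ∀ t → VShaped.apex profile-u ≤ t → t ≤ D → g t + D ≤ k + t
  g-after t a≤t t≤D = subst (_≤ k + t) (sym (after-apex profile-u t a≤t t≤D))
    (+-monoˡ-≤ t (subst (λ x → d x u′ ≤ k) (sym p[D]≡b) (proj₂ ends-near-u)))

  distance-from-u : ∀ {z} (O : OnDiameter z) e → Dist T u′ z e → e ≡ g (position O)
  distance-from-u O e Dist-e =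
    trans (Dist⇒≡d Dist-e) (trans (d-sym u′ _) (cong (λ x → d x u′) (sym (p[position]≡z O))))

  bound-on-diameter : ∀ t → t ≤ D → t ≤ r → D ≤ r + t → g t + r ≤ k + D % 2
  bound-on-diameter t t≤D t≤r D≤r+t with ≤-total t (VShaped.apex profile-u)
  ... | inj₁ t≤a = begin
    g t + r           ≤⟨ +-monoʳ-≤ (g t) r≤t+ρ ⟩
    g t + (t + ρ)     ≡⟨ sym (+-assoc (g t) t ρ) ⟩
    g t + t + ρ       ≤⟨ +-monoˡ-≤ ρ (g-before t t≤a) ⟩
    k + ρ             ∎
    where
      ρ = D % 2
      r≤t+ρ : r ≤ t + ρ
      r≤t+ρ = +-cancelˡ-≤ r r (t + ρ) (begin
        r + r         ≤⟨ r+r≤D+D%2 ⟩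
        D + ρ         ≤⟨ +-monoˡ-≤ ρ D≤r+t ⟩
        r + t + ρ     ≡⟨ +-assoc r t ρ ⟩
        r + (t + ρ)   ∎)
  ... | inj₂ a≤t = +-cancelʳ-≤ t _ _ (begin
    g t + r + t       ≡⟨ +-assoc (g t) r t ⟩
    g t + (r + t)     ≤⟨ +-monoʳ-≤ (g t) (≤-trans (+-monoʳ-≤ r t≤r) r+r≤D+D%2) ⟩
    g t + (D + ρ)     ≡⟨ sym (+-assoc (g t) D ρ) ⟩
    g t + D + ρ       ≤⟨ +-monoˡ-≤ ρ (g-after t a≤t t≤D) ⟩
    k + t + ρ         ≡⟨ xy∙z≈xz∙y k t ρ ⟩
    k + ρ + t         ∎)
    where ρ = D % 2

  center-bound : (z : Fin m) → Center T z → ∀ e → Dist T u′ z e → e + r ≤ k + D % 2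
  center-bound z cz e Dist-e =
    subst (λ e → e + r ≤ k + D % 2) (sym (distance-from-u O e Dist-e))
      (bound-on-diameter (position O) (position≤D O) (position≤r O) (D≤r+position O))
    where O = center-on-diameter z cz

  -- If u's profile still descends at r, use the end a and position r; otherwise b and r - 1.
  adjacent-bound : ∀ s t → s ≡ r → suc t ≡ r → t ≤ D → g s + r ≤ k ⊎ g t + r ≤ k
  adjacent-bound s t s≡r 1+t≡r t≤D with r ≤? VShaped.apex profile-u
  ... | yes r≤a = inj₁ (subst (λ s → g s + r ≤ k) (sym s≡r) (g-before r r≤a))
  ... | no r≰a = inj₂ (+-cancelʳ-≤ t _ _ (begin
    g t + r + t    ≡⟨ +-assoc (g t) r t ⟩
    g t + (r + t)  ≤⟨ +-monoʳ-≤ (g t) r+t≤D ⟩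
    g t + D        ≤⟨ g-after t a≤t t≤D ⟩
    k + t          ∎))
    where
      a≤t : VShaped.apex profile-u ≤ t
      a≤t = ≤-pred (subst (VShaped.apex profile-u <_) (sym 1+t≡r) (≰⇒> r≰a))
      r+t≤D : r + t ≤ D
      r+t≤D = ≤-pred (begin
        suc (r + t) ≡⟨ sym (+-suc r t) ⟩
        r + suc t   ≡⟨ cong (r +_) 1+t≡r ⟩
        r + r       ≤⟨ r+r≤1+D ⟩
        suc D       ∎)

  positions-bound : ∀ {z₁ z₂} (O₁ : OnDiameter z₁) (O₂ : OnDiameter z₂) →
                    position O₁ ≢ position O₂ →
                    g (position O₁) + r ≤ k ⊎ g (position O₂) + r ≤ k
  positions-bound O₁ O₂ t₁≢t₂ =
    [ (λ (t₁≡r , 1+t₂≡r) → adjacent-bound _ _ t₁≡r 1+t₂≡r (position≤D O₂))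
    , (λ (t₂≡r , 1+t₁≡r) → swap (adjacent-bound _ _ t₂≡r 1+t₁≡r (position≤D O₁))) ]′
    (two-positions r+r≤1+D t₁≢t₂ (position≤r O₁) (D≤r+position O₁)
                                 (position≤r O₂) (D≤r+position O₂))

  two-centers-bound : (z₁ z₂ : Fin m) → Center T z₁ → Center T z₂ → z₁ ≢ z₂ →
                      ∀ e₁ e₂ → Dist T u′ z₁ e₁ → Dist T u′ z₂ e₂ →
                      (e₁ + r ≤ k) ⊎ (e₂ + r ≤ k)
  two-centers-bound z₁ z₂ cz₁ cz₂ z₁≢z₂ e₁ e₂ Dist-e₁ Dist-e₂ =
    subst₂ (λ e₁ e₂ → e₁ + r ≤ k ⊎ e₂ + r ≤ k)
      (sym (distance-from-u O₁ e₁ Dist-e₁)) (sym (distance-from-u O₂ e₂ Dist-e₂))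
      (positions-bound O₁ O₂ t₁≢t₂)
    where
      O₁ = center-on-diameter z₁ cz₁
      O₂ = center-on-diameter z₂ cz₂
      t₁≢t₂ : position O₁ ≢ position O₂
      t₁≢t₂ t₁≡t₂ =
        z₁≢z₂ (trans (sym (p[position]≡z O₁)) (trans (cong p t₁≡t₂) (p[position]≡z O₂)))

lemma3 : (k : ℕ) → 2 ≤ k → {n m : ℕ} (G : Graph n) (T : Graph m)
    → (∃[ x ] ∃[ y ] (x ≢ y × ¬ Adj G x y))
    → (u : Fin n) → (∀ v → v ≢ u → Adj G u v)
    → (L : LeafRoot k G T)
    → (r D : ℕ) → Rad T r → Diam T D
    → ((z : Fin m) → Center T z → ∀ d → Dist T (LeafRoot.ι L u) z d
          → d + r ≤ k + D % 2)
      × ((z₁ z₂ : Fin m) → Center T z₁ → Center T z₂ → z₁ ≢ z₂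
          → ∀ d₁ d₂ → Dist T (LeafRoot.ι L u) z₁ d₁ → Dist T (LeafRoot.ι L u) z₂ d₂
          → (d₁ + r ≤ k) ⊎ (d₂ + r ≤ k))
lemma3 k _ G T _ u universal L r D rad diam = center-bound , two-centers-bound
  where open Bounds k G T L u universal r D rad diam
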